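{- Let $p$ be a prime, $q=p^2$, and $f=x^{q-p}\in\mathbb{F}_q[x]$. Then $\deg(S_f)=p$.
   Context: $\mathrm{PG}(2,q)$ is the projective plane over $\mathbb{F}_q$. For $f\in\mathbb{F}_q[x]$, $S_f=\{(x,f(x),1):x\in\mathbb{F}_q\}\cup\{(0,1,0)\}$. For a set $D$ of $q+1$ points, $u_i(D)$ is the number of lines of $\mathrm{PG}(2,q)$ containing exactly $i$ points of $D$, and $\deg(D)$ is the largest $i$ with $u_i(D)\neq 0$. -}

module Defs where

open import Level using (0ℓ)
open import Data.Nat using (ℕ; zero; suc; _⊔_) renaming (_+_ to _+ℕ_)
open import Data.Fin using (Fin)
open import Data.List using (List; []; _∷_; length; filter; map; foldr; concatMap; allFin)
open import Data.Product using (_×_; _,_; ∃)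
open import Relation.Nullary using (¬_; Dec; yes; no)
open import Relation.Nullary.Decidable using (¬?; _×-dec_)
open import Relation.Binary.PropositionalEquality using (_≡_)
open import Algebra.Bundles using (CommutativeRing; Semiring)
import Algebra.Definitions.RawSemiring as RawSemiringDefs

record FiniteField (q : ℕ) : Set₁ where
  field
    commRing : CommutativeRing 0ℓ 0ℓ
  open CommutativeRing commRing public
  field
    _≟_     : (x y : Carrier) → Dec (x ≈ y)
    1≉0     : ¬ (1# ≈ 0#)
    inverse : (x : Carrier) → ¬ (x ≈ 0#) → ∃ λ y → (x * y) ≈ 1#
    enum    : Fin q → Carrier
    enum-injective  : (i j : Fin q) → enum i ≈ enum j → i ≡ j
    enum-surjective : (x : Carrier) → ∃ λ i → enum i ≈ x

  _^_ : Carrier → ℕ → Carrier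
  _^_ = RawSemiringDefs._^_ (Semiring.rawSemiring semiring)

  elements : List Carrier
  elements = map enum (allFin q)

module PlaneCurve {q : ℕ} (F : FiniteField q) where
  open FiniteField F

  -- S_f = {(x, f x, 1) : x ∈ F_q} ∪ {(0,1,0)}.
  -- Number of points of S_f on the line a X + b Y + c Z = 0 of PG(2,q),
  -- where (a,b,c) ≠ (0,0,0) are homogeneous line coordinates.
  lineCount : (Carrier → Carrier) → Carrier → Carrier → Carrier → ℕ
  lineCount f a b c =
      length (filter (λ x → (((a * x) + (b * f x)) + c) ≟ 0#) elements)
    +ℕ (Dec→ℕ (b ≟ 0#))
    where
      Dec→ℕ : {P : Set} → Dec P → ℕ
      Dec→ℕ (yes _) = 1
      Dec→ℕ (no _)  = 0

  nonzeroTriples : List (Carrier × Carrier × Carrier)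
  nonzeroTriples =
    filter (λ { (a , b , c) → ¬? ((a ≟ 0#) ×-dec ((b ≟ 0#) ×-dec (c ≟ 0#))) })
      (concatMap (λ a → concatMap (λ b → map (λ c → (a , b , c)) elements) elements) elements)

  -- deg(S_f): the largest i such that some line of PG(2,q) meets S_f in
  -- exactly i points (lines = nonzero triples up to scalars; scaling a
  -- triple does not change the count).
  deg : (Carrier → Carrier) → ℕ
  deg f = foldr (λ { (a , b , c) m → lineCount f a b c ⊔ m }) 0 nonzeroTriples

module Submission where

-- By Fermat, x ^ q = x, so for x ≠ 0 the equation a x + b f(x) + c = 0 of a line,
-- multiplied by x ^ p, becomes a x ^ (p + 1) + b x + c x ^ p = 0.  If b, c ≠ 0 every point is then
-- a root of b + c X ^ (p - 1) + a X ^ p, a polynomial with nonzero constant term, so there are at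
-- most p of them.  If c = 0 the nonzero points satisfy a x ^ p = - b, and the Frobenius map is
-- injective, so the line has at most two points; if b = 0 it has at most one affine point
-- besides (0 : 1 : 0).  Conversely some α has α ^ p ≠ α (otherwise f = 1 on the q - 1 nonzero
-- elements, i.e. the line y = 1 would carry more than p points).  With m = α ^ p - α, additivity
-- of Frobenius in characteristic p shows that the p elements t = α + i, i ∈ 𝔽ₚ, satisfy
-- t ^ p = t + m, and then the p points x = t⁻¹ all lie on the line y = 1 + m x.

open import Defs
open import Algebra.Bundles using (CommutativeRing; CommutativeSemiring)
open import Data.Fin using (Fin; inject₁; fromℕ) renaming (zero to fzero; suc to fsuc)
import Data.Fin.Properties as Fin
open import Data.List using (List; []; _∷_; _++_; length; map; filter; foldr; concatMap; allFin; replicate)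
open import Data.List.Properties
  using (length-++; length-map; ++-identityʳ; length-tabulate; length-replicate; length-applyUpTo; filter-≐)
open import Data.List.Relation.Unary.All as All using (All; []; _∷_)
import Data.List.Relation.Unary.All.Properties as All
open import Data.List.Relation.Unary.Any as Any using (here; there; any?; satisfied)
open import Data.List.Relation.Unary.AllPairs using (_∷_)
open import Data.List.Relation.Unary.Unique.Propositional.Properties using (allFin⁺)
import Data.List.Membership.Propositional as Propositional
import Data.List.Membership.Propositional.Properties as Propositional
open import Data.Nat as ℕ using (ℕ; zero; suc; NonZero; _≤_; _<_; _∸_; _!; _⊔_; z≤n; s≤s; z<s; s<s; >-nonZero)
import Data.Nat.Properties as ℕ
open import Data.Nat.Combinatorics using (_C_; nCn≡1; k![n∸k]!∣n!; nCk≡n!/k![n-k]!)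
open import Data.Nat.Coprimality using (Coprime; coprime-Bézout; prime⇒coprime)
open import Data.Nat.Divisibility using (_∣_; divides; m∣m*n; n∣m*n; ∣1⇒≡1; ∣⇒≤)
open import Data.Nat.DivMod using (m/n*n≡m)
open import Data.Nat.GCD using (module Bézout)
open import Data.Nat.Primality using (Prime; euclidsLemma; prime⇒nonZero; prime⇒nonTrivial; ¬prime[0]; ¬prime[1])
open import Data.Product using (_×_; _,_; ∃; proj₁; proj₂)
open import Data.Sum using (inj₁; inj₂)
open import Function using (_∘_)
open import Relation.Binary using (Setoid; tri<; tri≈; tri>)
open import Relation.Binary.PropositionalEquality using (_≡_)
import Relation.Binary.PropositionalEquality as ≡
open import Relation.Nullary using (¬_; Dec; yes; no; contradiction; ¬?; _×-dec_)
open import Relation.Nullary.Decidable using (decidable-stable)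
open import Relation.Unary using (Pred; Decidable)

n∣n! : ∀ n → .{{NonZero n}} → n ∣ n !
n∣n! (suc n) = m∣m*n (n !)

nCk*[k!*[n∸k]!]≡n! : ∀ {n k} → k ≤ n → (n C k) ℕ.* (k ! ℕ.* (n ∸ k) !) ≡ n !
nCk*[k!*[n∸k]!]≡n! {n} {k} k≤n =
  ≡.trans (≡.cong (ℕ._* (k ! ℕ.* (n ∸ k) !)) (nCk≡n!/k![n-k]! k≤n)) (m/n*n≡m (k![n∸k]!∣n! k≤n))
  where instance _ = k ℕ.!* (n ∸ k) !≢0

n^2≡n*n : ∀ n → n ℕ.^ 2 ≡ n ℕ.* n
n^2≡n*n n = ≡.cong (n ℕ.*_) (ℕ.*-identityʳ n)

1+n<n^2 : ∀ {n} → 2 ≤ n → suc n < n ℕ.^ 2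
1+n<n^2 {n} 2≤n = begin-strict
  1 ℕ.+ n  <⟨ ℕ.+-monoˡ-< n 2≤n ⟩
  n ℕ.+ n  ≡⟨ ≡.cong (n ℕ.+_) (ℕ.+-identityʳ n) ⟨
  2 ℕ.* n  ≤⟨ ℕ.*-monoˡ-≤ n 2≤n ⟩
  n ℕ.* n  ≡⟨ n^2≡n*n n ⟨
  n ℕ.^ 2  ∎
  where open ℕ.≤-Reasoning

module _ {p} (p-prime : Prime p) where
  private instance
    p≢0 = prime⇒nonZero p-prime
    p>1 = prime⇒nonTrivial p-prime

  prime∤! : ∀ {m} → m < p → ¬ p ∣ m !
  prime∤! {zero}  _   p∣1  = ℕ.<⇒≢ (ℕ.nonTrivial⇒n>1 p) (≡.sym (∣1⇒≡1 p∣1))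
  prime∤! {suc m} m<p p∣m! with euclidsLemma (suc m) (m !) p-prime p∣m!
  ... | inj₁ p∣1+m = ℕ.<⇒≱ m<p (∣⇒≤ p∣1+m)
  ... | inj₂ p∣m!′ = prime∤! (ℕ.<-trans (ℕ.n<1+n m) m<p) p∣m!′

  prime∣C : ∀ {k} → 0 < k → k < p → p ∣ p C k
  prime∣C {k} 0<k k<p with euclidsLemma (p C k) (k ! ℕ.* (p ∸ k) !) p-prime
                             (≡.subst (p ∣_) (≡.sym (nCk*[k!*[n∸k]!]≡n! (ℕ.<⇒≤ k<p))) (n∣n! p))
  ... | inj₁ p∣C = p∣C
  ... | inj₂ p∣k!*[p∸k]! with euclidsLemma (k !) ((p ∸ k) !) p-prime p∣k!*[p∸k]!
  ...   | inj₁ p∣k!     = contradiction p∣k! (prime∤! k<p)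
  ...   | inj₂ p∣[p∸k]! = contradiction p∣[p∸k]! (prime∤! (ℕ.∸-monoʳ-< 0<k (ℕ.<⇒≤ k<p)))

module UniqueList {a ℓ} (S : Setoid a ℓ) where
  open Setoid S renaming (Carrier to A)
  open import Data.List.Membership.Setoid S using (_∈_; _∉_)
  open import Data.List.Membership.Setoid.Properties using (∈-resp-≈; ∈-map⁻; All[≉]⇒∉)
  open import Data.List.Relation.Binary.Subset.Setoid S using (_⊆_)
  open import Data.List.Relation.Unary.Unique.Setoid S using (Unique)
  open import Data.List.Relation.Unary.Unique.Setoid.Properties using (map⁺)
  open import Data.List.Relation.Binary.Permutation.Setoid S using (_↭_; prep; ↭-refl; ↭-reflexive; ↭-prep; ↭-swap; ↭-trans)
  open import Data.List.Relation.Binary.Permutation.Setoid.Properties S using (∈-resp-↭; xs↭ys⇒|xs|≡|ys|)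

  ∈⇒↭-∷ : ∀ {x ys} → x ∈ ys → ∃ λ zs → ys ↭ x ∷ zs
  ∈⇒↭-∷ {ys = _ ∷ ys} (here x≈y) = ys , prep (sym x≈y) ↭-refl
  ∈⇒↭-∷ {x} {y ∷ _} (there x∈ys) with zs , ys↭x∷zs ← ∈⇒↭-∷ x∈ys =
    y ∷ zs , ↭-trans (↭-prep y ys↭x∷zs) (↭-swap y x ↭-refl)

  ⊆-∷⇒⊆ : ∀ {x xs zs} → x ∉ xs → xs ⊆ x ∷ zs → xs ⊆ zs
  ⊆-∷⇒⊆ x∉xs xs⊆x∷zs v∈xs with xs⊆x∷zs v∈xs
  ... | here v≈x    = contradiction (∈-resp-≈ S v≈x v∈xs) x∉xs
  ... | there v∈zs = v∈zs

  unique-⊆⇒↭-++ : ∀ {xs ys} → Unique xs → xs ⊆ ys → ∃ λ zs → ys ↭ xs ++ zs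
  unique-⊆⇒↭-++ {[]} {ys} _ _ = ys , ↭-refl
  unique-⊆⇒↭-++ {x ∷ xs} (x≉xs ∷ xs!) x∷xs⊆ys
    with zs , ys↭x∷zs ← ∈⇒↭-∷ (x∷xs⊆ys (here refl))
    with ws , zs↭xs++ws ← unique-⊆⇒↭-++ xs! (⊆-∷⇒⊆ (All[≉]⇒∉ S x≉xs) (∈-resp-↭ ys↭x∷zs ∘ x∷xs⊆ys ∘ there))
    = ws , ↭-trans ys↭x∷zs (↭-prep x zs↭xs++ws)

  unique-⊆⇒length≤ : ∀ {xs ys} → Unique xs → xs ⊆ ys → length xs ≤ length ys
  unique-⊆⇒length≤ {xs} xs! xs⊆ys with zs , ys↭xs++zs ← unique-⊆⇒↭-++ xs! xs⊆ys =
    ℕ.≤-trans (ℕ.m≤m+n (length xs) (length zs))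
              (ℕ.≤-reflexive (≡.sym (≡.trans (xs↭ys⇒|xs|≡|ys| ys↭xs++zs) (length-++ xs))))

  unique-⊆-length≤⇒↭ : ∀ {xs ys} → Unique xs → xs ⊆ ys → length ys ≤ length xs → ys ↭ xs
  unique-⊆-length≤⇒↭ {xs} xs! xs⊆ys |ys|≤|xs| with unique-⊆⇒↭-++ xs! xs⊆ys
  ... | [] , ys↭xs++[] = ↭-trans ys↭xs++[] (↭-reflexive (++-identityʳ xs))
  ... | z ∷ zs , ys↭xs++z∷zs = contradiction
        (≡.subst (_≤ length xs) (≡.trans (xs↭ys⇒|xs|≡|ys| ys↭xs++z∷zs) (length-++ xs)) |ys|≤|xs|)
        (ℕ.m+1+n≰m (length xs))

  injective-map-↭ : ∀ {g : A → A} {xs} → (∀ {x y} → g x ≈ g y → x ≈ y) →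
                    (∀ {x} → x ∈ xs → g x ∈ xs) → Unique xs → xs ↭ map g xs
  injective-map-↭ {g} {xs} g-injective g-closed xs! =
    unique-⊆-length≤⇒↭ (map⁺ S S g-injective xs!) gxs⊆xs (ℕ.≤-reflexive (≡.sym (length-map g xs)))
    where
    gxs⊆xs : map g xs ⊆ xs
    gxs⊆xs v∈gxs with x , x∈xs , v≈gx ← ∈-map⁻ S S v∈gxs = ∈-resp-≈ S (sym v≈gx) (g-closed x∈xs)

module Polynomial {c ℓ} (S : CommutativeSemiring c ℓ) where
  open CommutativeSemiring S
  open import Algebra.Properties.Semiring.Exp semiring using (_^_)
  open import Algebra.Solver.Ring.NaturalCoefficients.Default S using (solve; _:+_; _:*_; _:=_; con)
  open import Relation.Binary.Reasoning.Setoid setoid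

  eval : List Carrier → Carrier → Carrier
  eval []       z = 0#
  eval (a ∷ as) z = a + z * eval as z

  quotient : Carrier → List Carrier → List Carrier
  quotient r []           = []
  quotient r (a ∷ [])     = []
  quotient r (a ∷ b ∷ bs) = eval (b ∷ bs) r ∷ quotient r (b ∷ bs)

  length-quotient : ∀ r a as → length (quotient r (a ∷ as)) ≡ length as
  length-quotient r a []       = ≡.refl
  length-quotient r a (b ∷ bs) = ≡.cong suc (length-quotient r b bs)

  -- P(z) = (z - r) Q(z) + P(r), with r Q(z) moved to the left so that no subtraction occurs.
  eval-quotient : ∀ r P z → eval P z + r * eval (quotient r P) z ≈ z * eval (quotient r P) z + eval P r
  eval-quotient r [] z = solve 2 (λ z r → con 0 :+ r :* con 0 := z :* con 0 :+ con 0) refl z r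
  eval-quotient r (a ∷ []) z =
    solve 3 (λ z r a → (a :+ z :* con 0) :+ r :* con 0 := z :* con 0 :+ (a :+ r :* con 0)) refl z r a
  eval-quotient r (a ∷ b ∷ bs) z = begin
    (a + z * A) + r * (B + z * Q)  ≈⟨ solve 6 (λ a z A r B Q → (a :+ z :* A) :+ r :* (B :+ z :* Q) := (a :+ r :* B) :+ z :* (A :+ r :* Q))
        refl a z A r B Q ⟩
    (a + r * B) + z * (A + r * Q)  ≈⟨ +-congˡ (*-congˡ (eval-quotient r (b ∷ bs) z)) ⟩
    (a + r * B) + z * (z * Q + B)  ≈⟨ solve 5 (λ a z r B Q → (a :+ r :* B) :+ z :* (z :* Q :+ B) := z :* (B :+ z :* Q) :+ (a :+ r :* B))
        refl a z r B Q ⟩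
    z * (B + z * Q) + (a + r * B)  ∎
    where
    A = eval (b ∷ bs) z
    B = eval (b ∷ bs) r
    Q = eval (quotient r (b ∷ bs)) z

  eval-replicate-0 : ∀ n P z → eval (replicate n 0# ++ P) z ≈ z ^ n * eval P z
  eval-replicate-0 zero    P z = sym (*-identityˡ _)
  eval-replicate-0 (suc n) P z = begin
    0# + z * eval (replicate n 0# ++ P) z  ≈⟨ +-identityˡ _ ⟩
    z * eval (replicate n 0# ++ P) z       ≈⟨ *-congˡ (eval-replicate-0 n P z) ⟩
    z * (z ^ n * eval P z)                 ≈⟨ *-assoc z (z ^ n) _ ⟨
    z * z ^ n * eval P z                   ∎

module Characteristic {c ℓ} (R : CommutativeRing c ℓ) where
  open CommutativeRing R
  open import Algebra.Properties.Semiring.Mult semiring using (×-congʳ; ×-assoc-*; ×1-homo-*; ×-homo-+)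
    renaming (_×_ to _×ₙ_)
  open import Algebra.Properties.Semiring.Exp semiring using (_^_)
  open import Algebra.Properties.CommutativeSemiring.Binomial commutativeSemiring using (theorem; binomialTerm)
  open import Algebra.Properties.Semiring.Sum semiring using (sum; sum-init-last; sum-cong-≋; sum-replicate-zero)
  open import Algebra.Properties.Group +-group using (identityʳ-unique)
  open import Relation.Binary.Reasoning.Setoid setoid

  ×≈×1* : ∀ n x → n ×ₙ x ≈ (n ×ₙ 1#) * x
  ×≈×1* n x = begin
    n ×ₙ x         ≈⟨ ×-congʳ n (*-identityˡ x) ⟨
    n ×ₙ (1# * x)  ≈⟨ ×-assoc-* n 1# x ⟨
    (n ×ₙ 1#) * x  ∎

  ∣⇒×1≈0 : ∀ {m n} → m ×ₙ 1# ≈ 0# → m ∣ n → n ×ₙ 1# ≈ 0#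
  ∣⇒×1≈0 {m} m≈0 (divides a ≡.refl) = begin
    (a ℕ.* m) ×ₙ 1#        ≈⟨ ×1-homo-* a m ⟩
    (a ×ₙ 1#) * (m ×ₙ 1#)  ≈⟨ *-congˡ m≈0 ⟩
    (a ×ₙ 1#) * 0#         ≈⟨ zeroʳ _ ⟩
    0#                     ∎

  1+am≡bn⇒1≈0 : ∀ {m n} a b → m ×ₙ 1# ≈ 0# → n ×ₙ 1# ≈ 0# → suc (a ℕ.* m) ≡ b ℕ.* n → 1# ≈ 0#
  1+am≡bn⇒1≈0 {m} {n} a b m≈0 n≈0 1+am≡bn = begin
    1#                    ≈⟨ +-identityʳ 1# ⟨
    1# + 0#               ≈⟨ +-congˡ (∣⇒×1≈0 m≈0 (n∣m*n a)) ⟨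
    1# + (a ℕ.* m) ×ₙ 1#  ≡⟨ ≡.cong (_×ₙ 1#) 1+am≡bn ⟩
    (b ℕ.* n) ×ₙ 1#       ≈⟨ ∣⇒×1≈0 n≈0 (n∣m*n b) ⟩
    0#                    ∎

  coprime⇒1≈0 : ∀ {m n} → Coprime m n → m ×ₙ 1# ≈ 0# → n ×ₙ 1# ≈ 0# → 1# ≈ 0#
  coprime⇒1≈0 m⊥n m≈0 n≈0 with coprime-Bézout m⊥n
  ... | Bézout.+- a b 1+bn≡am = 1+am≡bn⇒1≈0 b a n≈0 m≈0 1+bn≡am
  ... | Bézout.-+ a b 1+am≡bn = 1+am≡bn⇒1≈0 a b m≈0 n≈0 1+am≡bn

  zero-^ : ∀ n .{{_ : NonZero n}} → 0# ^ n ≈ 0#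
  zero-^ (suc n) = zeroˡ _

  one-^ : ∀ n → 1# ^ n ≈ 1#
  one-^ zero    = refl
  one-^ (suc n) = trans (*-identityˡ _) (one-^ n)

  freshman : ∀ n .{{_ : NonZero n}} → (∀ {k} z → 0 < k → k < n → (n C k) ×ₙ z ≈ 0#) →
             ∀ x y → (x + y) ^ n ≈ x ^ n + y ^ n
  freshman n@(suc m) inner≈0 x y = begin
    (x + y) ^ n                                                      ≈⟨ theorem n x y ⟩
    t fzero + sum (λ i → t (fsuc i))                                 ≈⟨ +-cong first (sum-init-last (λ i → t (fsuc i))) ⟩
    y ^ n + (sum (λ i → t (fsuc (inject₁ i))) + t (fsuc (fromℕ m)))  ≈⟨ +-congˡ (+-cong middle last) ⟩
    y ^ n + (0# + x ^ n)                                             ≈⟨ +-congˡ (+-identityˡ _) ⟩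
    y ^ n + x ^ n                                                    ≈⟨ +-comm _ _ ⟩
    x ^ n + y ^ n                                                    ∎
    where
    t = binomialTerm x y n
    first : t fzero ≈ y ^ n
    first = trans (+-identityʳ _) (*-identityˡ _)
    middle : sum (λ i → t (fsuc (inject₁ i))) ≈ 0#
    middle = trans (sum-cong-≋ (λ i → inner≈0 _ z<s (s<s (Fin.inject₁ℕ< i)))) (sum-replicate-zero m)
    last : t (fsuc (fromℕ m)) ≈ x ^ n
    last rewrite Fin.toℕ-fromℕ m | nCn≡1 n | ℕ.n∸n≡0 m = trans (+-identityʳ _) (*-identityʳ _)

  module PrimeCharacteristic {p} (p-prime : Prime p) (p×1≈0 : p ×ₙ 1# ≈ 0#) where
    private instance _ = prime⇒nonZero p-prime

    frobenius-+ : ∀ x y → (x + y) ^ p ≈ x ^ p + y ^ p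
    frobenius-+ = freshman p λ {k} z 0<k k<p →
      trans (×≈×1* (p C k) z) (trans (*-congʳ (∣⇒×1≈0 p×1≈0 (prime∣C p-prime 0<k k<p))) (zeroˡ z))

    frobenius-×1 : ∀ n → (n ×ₙ 1#) ^ p ≈ n ×ₙ 1#
    frobenius-×1 zero    = zero-^ p
    frobenius-×1 (suc n) = trans (frobenius-+ 1# (n ×ₙ 1#)) (+-cong (one-^ p) (frobenius-×1 n))

    module _ (1≉0 : 1# ≉ 0#) where

      ×1≉0 : ∀ {i} → 0 < i → i < p → i ×ₙ 1# ≉ 0#
      ×1≉0 0<i i<p i≈0 = 1≉0 (coprime⇒1≈0 (prime⇒coprime p-prime {{>-nonZero 0<i}} i<p) p×1≈0 i≈0)

      <⇒×1≉ : ∀ {i j} → i < j → j < p → i ×ₙ 1# ≉ j ×ₙ 1#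
      <⇒×1≉ {i} {j} i<j j<p i≈j = ×1≉0 (ℕ.m<n⇒0<n∸m i<j) (ℕ.≤-<-trans (ℕ.m∸n≤m j i) j<p)
        (identityʳ-unique (i ×ₙ 1#) ((j ∸ i) ×ₙ 1#) (begin
          i ×ₙ 1# + (j ∸ i) ×ₙ 1#  ≈⟨ ×-homo-+ 1# i (j ∸ i) ⟨
          (i ℕ.+ (j ∸ i)) ×ₙ 1#    ≡⟨ ≡.cong (_×ₙ 1#) (ℕ.m+[n∸m]≡n (ℕ.<⇒≤ i<j)) ⟩
          j ×ₙ 1#                  ≈⟨ i≈j ⟨
          i ×ₙ 1#                  ∎))

      ×1-injective : ∀ {i j} → i < p → j < p → i ×ₙ 1# ≈ j ×ₙ 1# → i ≡ j
      ×1-injective {i} {j} i<p j<p i≈j with ℕ.<-cmp i j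
      ... | tri< i<j _ _ = contradiction i≈j (<⇒×1≉ i<j j<p)
      ... | tri≈ _ i≡j _ = i≡j
      ... | tri> _ _ j<i = contradiction (sym i≈j) (<⇒×1≉ j<i i<p)

module FiniteFieldProperties {q} (F : FiniteField q) where
  open FiniteField F
  open import Algebra.Solver.Ring.NaturalCoefficients.Default commutativeSemiring using (solve; _:+_; _:*_; _:=_; con)
  open import Algebra.Properties.Semiring.Exp semiring using (^-congʳ)
  open import Algebra.Properties.Semiring.Mult semiring using () renaming (_×_ to _×ₙ_)
  open import Algebra.Properties.Group +-group using (identityˡ-unique; ∙-cancelˡ)
  open import Data.List.Membership.Setoid setoid using (_∈_)
  open import Data.List.Membership.Setoid.Properties using (∈-resp-≈; ∈-map⁺; ∈-filter⁺; ∈-filter⁻)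
  open import Data.List.Relation.Unary.Unique.Setoid setoid using (Unique)
  import Data.List.Relation.Unary.Unique.Setoid.Properties as Unique
  open import Data.List.Relation.Binary.Permutation.Setoid setoid using (_↭_)
  open import Data.List.Relation.Binary.Permutation.Setoid.Properties setoid
    using (∈-resp-↭; Unique-resp-↭; xs↭ys⇒|xs|≡|ys|; foldr-commMonoid)
  open UniqueList setoid
  open Polynomial commutativeSemiring using (eval; quotient; length-quotient; eval-quotient)
  open import Relation.Binary.Reasoning.Setoid setoid

  *-cancelˡ-≉0 : ∀ {a x y} → a ≉ 0# → a * x ≈ a * y → x ≈ y
  *-cancelˡ-≉0 {a} {x} {y} a≉0 ax≈ay with a⁻¹ , a*a⁻¹≈1 ← inverse a a≉0 = begin
    x              ≈⟨ a⁻¹*[a*z]≈z x ⟨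
    a⁻¹ * (a * x)  ≈⟨ *-congˡ ax≈ay ⟩
    a⁻¹ * (a * y)  ≈⟨ a⁻¹*[a*z]≈z y ⟩
    y              ∎
    where
    a⁻¹*[a*z]≈z : ∀ z → a⁻¹ * (a * z) ≈ z
    a⁻¹*[a*z]≈z z = begin
      a⁻¹ * (a * z)  ≈⟨ *-assoc a⁻¹ a z ⟨
      (a⁻¹ * a) * z  ≈⟨ *-congʳ (trans (*-comm a⁻¹ a) a*a⁻¹≈1) ⟩
      1# * z         ≈⟨ *-identityˡ z ⟩
      z              ∎

  x*y≈0⇒y≈0 : ∀ {x y} → x ≉ 0# → x * y ≈ 0# → y ≈ 0#
  x*y≈0⇒y≈0 {x} x≉0 xy≈0 = *-cancelˡ-≉0 x≉0 (trans xy≈0 (sym (zeroʳ x)))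

  *-≉0 : ∀ {x y} → x ≉ 0# → y ≉ 0# → x * y ≉ 0#
  *-≉0 x≉0 y≉0 = y≉0 ∘ x*y≈0⇒y≈0 x≉0

  x*z≈y*z⇒z≈0 : ∀ {x y z} → x ≉ y → x * z ≈ y * z → z ≈ 0#
  x*z≈y*z⇒z≈0 {x} {y} {z} x≉y xz≈yz with z ≟ 0#
  ... | yes z≈0 = z≈0
  ... | no  z≉0 = contradiction (*-cancelˡ-≉0 z≉0 (trans (*-comm z x) (trans xz≈yz (*-comm y z)))) x≉y

  -1≉0 : - 1# ≉ 0#
  -1≉0 -1≈0 = 1≉0 (trans (sym (+-identityʳ 1#)) (trans (+-congˡ (sym -1≈0)) (-‿inverseʳ 1#)))

  roots-bound : ∀ P {xs} → eval P 0# ≉ 0# → Unique xs → All (λ x → eval P x ≈ 0#) xs → length xs < length P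
  roots-bound []       P0≉0 _ _ = contradiction refl P0≉0
  roots-bound (_ ∷ _)  {[]} _ _ _ = s≤s z≤n
  roots-bound (a ∷ as) {x ∷ xs} P0≉0 (x≉xs ∷ xs!) (Px≈0 ∷ Pxs≈0) =
    s≤s (≡.subst (length xs <_) (length-quotient x a as) (roots-bound Q Q0≉0 xs! Qxs≈0))
    where
    P = a ∷ as
    Q = quotient x P
    factor : ∀ z → eval P z + x * eval Q z ≈ z * eval Q z
    factor z = trans (eval-quotient x P z) (trans (+-congˡ Px≈0) (+-identityʳ _))
    Q0≉0 : eval Q 0# ≉ 0#
    Q0≉0 Q0≈0 = P0≉0 (begin
      eval P 0#                  ≈⟨ +-identityʳ _ ⟨
      eval P 0# + 0#             ≈⟨ +-congˡ (trans (*-congˡ Q0≈0) (zeroʳ x)) ⟨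
      eval P 0# + x * eval Q 0#  ≈⟨ factor 0# ⟩
      0# * eval Q 0#             ≈⟨ zeroˡ _ ⟩
      0#                         ∎)
    Qxs≈0 : All (λ y → eval Q y ≈ 0#) xs
    Qxs≈0 = All.zipWith (λ (x≉y , Py≈0) → x*z≈y*z⇒z≈0 x≉y (begin
      x * eval Q _             ≈⟨ +-identityˡ _ ⟨
      0# + x * eval Q _        ≈⟨ +-congʳ Py≈0 ⟨
      eval P _ + x * eval Q _  ≈⟨ factor _ ⟩
      _ * eval Q _             ∎)) (x≉xs , Pxs≈0)

  elements-unique : Unique elements
  elements-unique = Unique.map⁺ (≡.setoid (Fin q)) setoid (enum-injective _ _) (allFin⁺ q)

  ∈-elements : ∀ x → x ∈ elements
  ∈-elements x with i , enum-i≈x ← enum-surjective x =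
    ∈-resp-≈ setoid enum-i≈x (∈-map⁺ (≡.setoid (Fin q)) setoid {f = enum} (reflexive ∘ ≡.cong enum) (Propositional.∈-allFin i))

  length-elements : length elements ≡ q
  length-elements = ≡.trans (length-map enum (allFin q)) (length-tabulate (λ i → i))

  ∈-0∷⁺ : ∀ {x ys} → (x ≉ 0# → x ∈ ys) → x ∈ 0# ∷ ys
  ∈-0∷⁺ {x} x≉0⇒x∈ys with x ≟ 0#
  ... | yes x≈0 = here x≈0
  ... | no  x≉0 = there (x≉0⇒x∈ys x≉0)

  count : ∀ {r} {P : Pred Carrier r} → Decidable P → ℕ
  count P? = length (filter P? elements)

  count-<-roots : ∀ {r} {P : Pred Carrier r} (P? : Decidable P) Q → eval Q 0# ≉ 0# →
                  (∀ {x} → P x → eval Q x ≈ 0#) → count P? < length Q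
  count-<-roots P? Q Q0≉0 P⇒root =
    roots-bound Q Q0≉0 (Unique.filter⁺ setoid P? {elements} elements-unique) (All.map P⇒root (All.all-filter P? elements))

  module _ {r} {P : Pred Carrier r} (P? : Decidable P) (P-resp : ∀ {x y} → x ≈ y → P x → P y) where

    count-≤ : ∀ {ys} → (∀ {x} → P x → x ∈ ys) → count P? ≤ length ys
    count-≤ P⊆ys = unique-⊆⇒length≤ (Unique.filter⁺ setoid P? {elements} elements-unique)
                                     (P⊆ys ∘ proj₂ ∘ ∈-filter⁻ setoid P? P-resp {xs = elements})

    ≤-count : ∀ {xs} → Unique xs → All P xs → length xs ≤ count P?
    ≤-count xs! Pxs = unique-⊆⇒length≤ xs! λ {x} x∈xs →
      ∈-filter⁺ setoid P? P-resp (∈-elements x) (All.lookupWith (λ Pw x≈w → P-resp (sym x≈w) Pw) Pxs x∈xs)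

    ∃? : Dec (∃ P)
    ∃? with any? P? elements
    ... | yes some = yes (satisfied some)
    ... | no  none = no λ (x , Px) → none (Any.map (λ x≈w → P-resp x≈w Px) (∈-elements x))

    count-≤1 : (∀ {x y} → P x → P y → x ≈ y) → count P? ≤ 1
    count-≤1 P-unique with ∃?
    ... | yes (r , Pr) = count-≤ {r ∷ []} λ Px → here (P-unique Px Pr)
    ... | no  ∄P       = ℕ.m≤n⇒m≤1+n (count-≤ {[]} λ {x} Px → contradiction (x , Px) ∄P)

  units : List Carrier
  units = proj₁ (∈⇒↭-∷ (∈-elements 0#))

  elements↭0∷units : elements ↭ 0# ∷ units
  elements↭0∷units = proj₂ (∈⇒↭-∷ (∈-elements 0#))

  q≡1+|units| : q ≡ suc (length units)
  q≡1+|units| = ≡.trans (≡.sym length-elements) (xs↭ys⇒|xs|≡|ys| elements↭0∷units)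

  private
    0∷units-unique : Unique (0# ∷ units)
    0∷units-unique = Unique-resp-↭ elements↭0∷units elements-unique

  units-unique : Unique units
  units-unique with _ ∷ units! ← 0∷units-unique = units!

  units-≉0 : All (_≉ 0#) units
  units-≉0 with 0≉units ∷ _ ← 0∷units-unique = All.map (λ 0≉x x≈0 → 0≉x (sym x≈0)) 0≉units

  ∈-units⁺ : ∀ {x} → x ≉ 0# → x ∈ units
  ∈-units⁺ {x} x≉0 with ∈-resp-↭ elements↭0∷units (∈-elements x)
  ... | here  x≈0     = contradiction x≈0 x≉0
  ... | there x∈units = x∈units

  ∈-units⁻ : ∀ {x} → x ∈ units → x ≉ 0#
  ∈-units⁻ x∈units x≈0 = All.lookupWith (λ w≉0 x≈w → w≉0 (trans (sym x≈w) x≈0)) units-≉0 x∈units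

  ∏ : List Carrier → Carrier
  ∏ = foldr _*_ 1#

  ∏-≉0 : ∀ {xs} → All (_≉ 0#) xs → ∏ xs ≉ 0#
  ∏-≉0 []            = 1≉0
  ∏-≉0 (x≉0 ∷ xs≉0) = *-≉0 x≉0 (∏-≉0 xs≉0)

  ∏-map-* : ∀ a xs → ∏ (map (a *_) xs) ≈ a ^ length xs * ∏ xs
  ∏-map-* a []       = sym (*-identityʳ 1#)
  ∏-map-* a (x ∷ xs) = begin
    a * x * ∏ (map (a *_) xs)       ≈⟨ *-congˡ (∏-map-* a xs) ⟩
    a * x * (a ^ length xs * ∏ xs)  ≈⟨ solve 4 (λ a x aⁿ P → a :* x :* (aⁿ :* P) := a :* aⁿ :* (x :* P))
        refl a x (a ^ length xs) (∏ xs) ⟩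
    a * a ^ length xs * (x * ∏ xs)  ∎

  ^-|units|≈1 : ∀ {a} → a ≉ 0# → a ^ length units ≈ 1#
  ^-|units|≈1 {a} a≉0 = *-cancelˡ-≉0 (∏-≉0 units-≉0) (begin
    ∏ units * a ^ length units  ≈⟨ *-comm _ _ ⟩
    a ^ length units * ∏ units  ≈⟨ ∏-map-* a units ⟨
    ∏ (map (a *_) units)        ≈⟨ foldr-commMonoid *-isCommutativeMonoid units↭a*units ⟨
    ∏ units                     ≈⟨ *-identityʳ _ ⟨
    ∏ units * 1#                ∎)
    where
    units↭a*units : units ↭ map (a *_) units
    units↭a*units = injective-map-↭ (*-cancelˡ-≉0 a≉0) (∈-units⁺ ∘ *-≉0 a≉0 ∘ ∈-units⁻) units-unique

  fermat : ∀ x → x ^ q ≈ x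
  fermat x = trans (^-congʳ x q≡1+|units|) (x*x^|units|≈x (x ≟ 0#))
    where
    x*x^|units|≈x : Dec (x ≈ 0#) → x * x ^ length units ≈ x
    x*x^|units|≈x (yes x≈0) = trans (*-congʳ x≈0) (trans (zeroˡ _) (sym x≈0))
    x*x^|units|≈x (no x≉0)  = trans (*-congˡ (^-|units|≈1 x≉0)) (*-identityʳ x)

  ∑ : List Carrier → Carrier
  ∑ = foldr _+_ 0#

  ∑-map-1+ : ∀ xs → ∑ (map (1# +_) xs) ≈ length xs ×ₙ 1# + ∑ xs
  ∑-map-1+ []       = sym (+-identityˡ 0#)
  ∑-map-1+ (x ∷ xs) = begin
    1# + x + ∑ (map (1# +_) xs)        ≈⟨ +-congˡ (∑-map-1+ xs) ⟩
    1# + x + (length xs ×ₙ 1# + ∑ xs)  ≈⟨ solve 3 (λ x n S → con 1 :+ x :+ (n :+ S) := con 1 :+ n :+ (x :+ S))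
        refl x (length xs ×ₙ 1#) (∑ xs) ⟩
    1# + length xs ×ₙ 1# + (x + ∑ xs)   ∎

  q×1≈0 : q ×ₙ 1# ≈ 0#
  q×1≈0 = identityˡ-unique (q ×ₙ 1#) (∑ elements) (begin
    q ×ₙ 1# + ∑ elements                ≡⟨ ≡.cong (λ n → n ×ₙ 1# + ∑ elements) length-elements ⟨
    length elements ×ₙ 1# + ∑ elements  ≈⟨ ∑-map-1+ elements ⟨
    ∑ (map (1# +_) elements)            ≈⟨ foldr-commMonoid +-isCommutativeMonoid elements↭1+elements ⟨
    ∑ elements                          ∎)
    where
    elements↭1+elements : elements ↭ map (1# +_) elements
    elements↭1+elements = injective-map-↭ (∙-cancelˡ 1# _ _) (λ _ → ∈-elements _) elements-unique

foldr-⊔-≤ : ∀ {A : Set} (g : A → ℕ) {n xs} → All (λ x → g x ≤ n) xs → foldr (λ x m → g x ⊔ m) 0 xs ≤ n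
foldr-⊔-≤ g []             = z≤n
foldr-⊔-≤ g (gx≤n ∷ gxs≤n) = ℕ.⊔-lub gx≤n (foldr-⊔-≤ g gxs≤n)

≤-foldr-⊔ : ∀ {A : Set} (g : A → ℕ) {x xs} → x Propositional.∈ xs → g x ≤ foldr (λ x m → g x ⊔ m) 0 xs
≤-foldr-⊔ g {xs = y ∷ _} (here ≡.refl) = ℕ.m≤m⊔n (g y) _
≤-foldr-⊔ g {xs = y ∷ _} (there x∈ys)  = ℕ.≤-trans (≤-foldr-⊔ g x∈ys) (ℕ.m≤n⊔m (g y) _)

module DegreeBounds {q} (F : FiniteField q) where
  open FiniteField F
  open PlaneCurve F

  lineCountᵗ : (Carrier → Carrier) → Carrier × Carrier × Carrier → ℕ
  lineCountᵗ f (a , b , c) = lineCount f a b c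

  triples : List (Carrier × Carrier × Carrier)
  triples = concatMap (λ a → concatMap (λ b → map (λ c → (a , b , c)) elements) elements) elements

  deg-≤ : ∀ f {n} → (∀ a b c → ¬ (a ≈ 0# × (b ≈ 0# × c ≈ 0#)) → lineCount f a b c ≤ n) → deg f ≤ n
  deg-≤ f bound = foldr-⊔-≤ (lineCountᵗ f) (All.map (λ {(a , b , c)} → bound a b c) (All.all-filter _ triples))

  filter-onLine-cong : ∀ (f : Carrier → Carrier) {a b c a′ b′ c′} → a ≈ a′ → b ≈ b′ → c ≈ c′ →
    filter (λ x → ((a * x + b * f x) + c) ≟ 0#) elements ≡ filter (λ x → ((a′ * x + b′ * f x) + c′) ≟ 0#) elements
  filter-onLine-cong f a≈a′ b≈b′ c≈c′ = filter-≐ _ _ (trans (sym line≈) , trans line≈) elements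
    where
    line≈ : ∀ {x} → (_ * x + _ * f x) + _ ≈ (_ * x + _ * f x) + _
    line≈ = +-cong (+-cong (*-congʳ a≈a′) (*-congʳ b≈b′)) c≈c′

  lineCount-cong : ∀ (f : Carrier → Carrier) {a b c a′ b′ c′} → a ≈ a′ → b ≈ b′ → c ≈ c′ →
                   lineCount f a b c ≡ lineCount f a′ b′ c′
  lineCount-cong f {b = b} {b′ = b′} a≈a′ b≈b′ c≈c′ with b ≟ 0# | b′ ≟ 0#
  ... | yes _   | yes _    = ≡.cong (λ xs → length xs ℕ.+ 1) (filter-onLine-cong f a≈a′ b≈b′ c≈c′)
  ... | no _    | no _     = ≡.cong (λ xs → length xs ℕ.+ 0) (filter-onLine-cong f a≈a′ b≈b′ c≈c′)
  ... | yes b≈0 | no b′≉0  = contradiction (trans (sym b≈b′) b≈0) b′≉0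
  ... | no b≉0  | yes b′≈0 = contradiction (trans b≈b′ b′≈0) b≉0

  representative : ∀ x → ∃ λ x′ → x′ Propositional.∈ elements × x′ ≈ x
  representative x with i , enum-i≈x ← enum-surjective x =
    enum i , Propositional.∈-map⁺ enum (Propositional.∈-allFin i) , enum-i≈x

  ∈-triples : ∀ {a b c} → a Propositional.∈ elements → b Propositional.∈ elements → c Propositional.∈ elements →
              (a , b , c) Propositional.∈ triples
  ∈-triples a∈ b∈ c∈ =
    Propositional.∈-concatMap⁺ _ (Propositional.lose a∈ (Propositional.∈-concatMap⁺ _ (Propositional.lose b∈ (Propositional.∈-map⁺ _ c∈))))

  ≤-deg : ∀ f {a b c n} → ¬ (a ≈ 0# × (b ≈ 0# × c ≈ 0#)) → n ≤ lineCount f a b c → n ≤ deg f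
  ≤-deg f {a} {b} {c} abc≉0 n≤count
    with a′ , a′∈ , a′≈a ← representative a
    with b′ , b′∈ , b′≈b ← representative b
    with c′ , c′∈ , c′≈c ← representative c
    = ℕ.≤-trans n≤count (ℕ.≤-trans (ℕ.≤-reflexive (lineCount-cong f (sym a′≈a) (sym b′≈b) (sym c′≈c)))
        (≤-foldr-⊔ (lineCountᵗ f) (Propositional.∈-filter⁺ _ (∈-triples a′∈ b′∈ c′∈)
          λ (a′≈0 , b′≈0 , c′≈0) → abc≉0 (trans (sym a′≈a) a′≈0 , trans (sym b′≈b) b′≈0 , trans (sym c′≈c) c′≈0))))

-- Writing p = 2 + k lets x ^ p unfold to x * (x * x ^ k).
module PowerCurve (k : ℕ) (p-prime : Prime (2 ℕ.+ k)) (F : FiniteField ((2 ℕ.+ k) ℕ.^ 2)) where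
  open FiniteField F
  open FiniteFieldProperties F
  open PlaneCurve F
  open Polynomial commutativeSemiring using (eval; eval-replicate-0)
  open Characteristic commRing using (zero-^; one-^)
  open import Algebra.Properties.Semiring.Exp semiring using (^-congˡ; ^-homo-*; ^-assocʳ)
  open import Algebra.Properties.CommutativeSemiring.Exp commutativeSemiring using (^-distrib-*)
  open import Algebra.Properties.Semiring.Mult semiring using (×1-homo-*) renaming (_×_ to _×ₙ_)
  open import Algebra.Properties.Group +-group using (∙-cancelˡ; ∙-cancelʳ; x∙y⁻¹≈ε⇒x≈y)
  open import Algebra.Properties.Ring ring using (-‿distribˡ-*)
  open import Algebra.Solver.Ring.NaturalCoefficients.Default commutativeSemiring using (solve; _:+_; _:*_; _:=_; con)
  open import Data.List.Membership.Setoid setoid using (_∈_)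
  import Data.List.Relation.Unary.Unique.Setoid.Properties as Unique
  open import Relation.Binary.Reasoning.Setoid setoid

  p : ℕ
  p = 2 ℕ.+ k

  e : ℕ
  e = p ℕ.^ 2 ∸ p

  f : Carrier → Carrier
  f x = x ^ e

  2≤p : 2 ≤ p
  2≤p = ℕ.m≤m+n 2 k

  p<p² : p < p ℕ.^ 2
  p<p² = ℕ.<-trans (ℕ.n<1+n p) (1+n<n^2 2≤p)

  f[x]*x^p≈x : ∀ x → f x * x ^ p ≈ x
  f[x]*x^p≈x x = begin
    x ^ e * x ^ p  ≈⟨ ^-homo-* x e p ⟨
    x ^ (e ℕ.+ p)  ≡⟨ ≡.cong (x ^_) (ℕ.m∸n+n≡m (ℕ.<⇒≤ p<p²)) ⟩
    x ^ (p ℕ.^ 2)  ≈⟨ fermat x ⟩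
    x              ∎

  p×1≈0 : p ×ₙ 1# ≈ 0#
  p×1≈0 with (p ×ₙ 1#) ≟ 0#
  ... | yes p≈0 = p≈0
  ... | no  p≉0 = contradiction (x*y≈0⇒y≈0 p≉0 (begin
    p ×ₙ 1# * p ×ₙ 1#  ≈⟨ ×1-homo-* p p ⟨
    (p ℕ.* p) ×ₙ 1#    ≡⟨ ≡.cong (_×ₙ 1#) (n^2≡n*n p) ⟨
    (p ℕ.^ 2) ×ₙ 1#    ≈⟨ q×1≈0 ⟩
    0#                 ∎)) p≉0

  open Characteristic.PrimeCharacteristic commRing p-prime p×1≈0 using (frobenius-+; frobenius-×1; ×1-injective)

  ^p-injective : ∀ {x y} → x ^ p ≈ y ^ p → x ≈ y
  ^p-injective {x} {y} x^p≈y^p = begin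
    x              ≈⟨ fermat x ⟨
    x ^ (p ℕ.^ 2)  ≡⟨ ≡.cong (x ^_) (n^2≡n*n p) ⟩
    x ^ (p ℕ.* p)  ≈⟨ ^-assocʳ x p p ⟨
    (x ^ p) ^ p    ≈⟨ ^-congˡ p x^p≈y^p ⟩
    (y ^ p) ^ p    ≈⟨ ^-assocʳ y p p ⟩
    y ^ (p ℕ.* p)  ≡⟨ ≡.cong (y ^_) (n^2≡n*n p) ⟨
    y ^ (p ℕ.^ 2)  ≈⟨ fermat y ⟩
    y              ∎

  OnLine : Carrier → Carrier → Carrier → Carrier → Set
  OnLine a b c x = (a * x + b * f x) + c ≈ 0#

  onLine? : ∀ a b c x → Dec (OnLine a b c x)
  onLine? a b c x = ((a * x + b * f x) + c) ≟ 0#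

  OnLine-resp : ∀ {a b c x y} → x ≈ y → OnLine a b c x → OnLine a b c y
  OnLine-resp x≈y = trans (+-congʳ (+-cong (*-congˡ (sym x≈y)) (*-congˡ (^-congˡ e (sym x≈y)))))

  points : Carrier → Carrier → Carrier → ℕ
  points a b c = count (onLine? a b c)

  x^p*line≈ : ∀ a b c x → x ^ p * ((a * x + b * f x) + c) ≈ a * x ^ p * x + b * x + c * x ^ p
  x^p*line≈ a b c x = begin
    x ^ p * ((a * x + b * f x) + c)  ≈⟨ solve 6 (λ a b c x xᵖ y → xᵖ :* ((a :* x :+ b :* y) :+ c) := a :* xᵖ :* x :+ b :* (y :* xᵖ) :+ c :* xᵖ)
        refl a b c x (x ^ p) (f x) ⟩
    a * x ^ p * x + b * (f x * x ^ p) + c * x ^ p  ≈⟨ +-congʳ (+-congˡ (*-congˡ (f[x]*x^p≈x x))) ⟩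
    a * x ^ p * x + b * x + c * x ^ p              ∎

  on-line-at-0⇒c≈0 : ∀ {a b c x} → OnLine a b c x → x ≈ 0# → c ≈ 0#
  on-line-at-0⇒c≈0 {a} {b} {c} {x} on x≈0 = begin
    c                      ≈⟨ +-identityˡ c ⟨
    0# + c                 ≈⟨ +-congʳ (+-identityʳ 0#) ⟨
    (0# + 0#) + c          ≈⟨ +-congʳ (+-cong (trans (*-congˡ x≈0) (zeroʳ a)) (trans (*-congˡ f[x]≈0) (zeroʳ b))) ⟨
    (a * x + b * f x) + c  ≈⟨ on ⟩
    0#                     ∎
    where
    f[x]≈0 : f x ≈ 0#
    f[x]≈0 = trans (^-congˡ e x≈0) (zero-^ e {{ℕ.>-nonZero (ℕ.m<n⇒0<n∸m p<p²)}})

  points-≤1 : ∀ {a b c} → b ≈ 0# → ¬ (a ≈ 0# × c ≈ 0#) → points a b c ≤ 1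
  points-≤1 {a} {b} {c} b≈0 ac≉0 = count-≤1 (onLine? a b c) OnLine-resp on-line-unique
    where
    affine : ∀ {x} → OnLine a b c x → a * x + c ≈ 0#
    affine {x} on = trans (+-congʳ (trans (sym (+-identityʳ _)) (+-congˡ (sym (trans (*-congʳ b≈0) (zeroˡ _)))))) on
    on-line-unique : ∀ {x y} → OnLine a b c x → OnLine a b c y → x ≈ y
    on-line-unique {x} on-x on-y with a ≟ 0#
    ... | yes a≈0 = contradiction (a≈0 , trans (sym (trans (+-congʳ (trans (*-congʳ a≈0) (zeroˡ x))) (+-identityˡ c))) (affine on-x)) ac≉0
    ... | no  a≉0 = *-cancelˡ-≉0 a≉0 (∙-cancelʳ c _ _ (trans (affine on-x) (sym (affine on-y))))

  trinomial : Carrier → Carrier → Carrier → List Carrier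
  trinomial a b c = b ∷ replicate k 0# ++ c ∷ a ∷ []

  length-trinomial : ∀ a b c → length (trinomial a b c) ≡ suc p
  length-trinomial a b c = ≡.cong suc
    (≡.trans (length-++ (replicate k 0#)) (≡.trans (≡.cong (ℕ._+ 2) (length-replicate k)) (ℕ.+-comm k 2)))

  x*trinomial≈ : ∀ a b c x → x * eval (trinomial a b c) x ≈ a * x ^ p * x + b * x + c * x ^ p
  x*trinomial≈ a b c x = begin
    x * (b + x * eval (replicate k 0# ++ c ∷ a ∷ []) x)  ≈⟨ *-congˡ (+-congˡ (*-congˡ (eval-replicate-0 k (c ∷ a ∷ []) x))) ⟩
    x * (b + x * (x ^ k * (c + x * (a + x * 0#))))       ≈⟨ solve 5 (λ a b c x xᵏ → x :* (b :+ x :* (xᵏ :* (c :+ x :* (a :+ x :* con 0))))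
                                                                := a :* (x :* (x :* xᵏ)) :* x :+ b :* x :+ c :* (x :* (x :* xᵏ)))
        refl a b c x (x ^ k) ⟩
    a * x ^ p * x + b * x + c * x ^ p                     ∎

  points-≤p : ∀ {a b c} → b ≉ 0# → c ≉ 0# → points a b c ≤ p
  points-≤p {a} {b} {c} b≉0 c≉0 = ℕ.≤-pred (≡.subst (points a b c <_) (length-trinomial a b c)
    (count-<-roots (onLine? a b c) (trinomial a b c) (b≉0 ∘ trans (sym (trans (+-congˡ (zeroˡ _)) (+-identityʳ b)))) on-line⇒root))
    where
    on-line⇒root : ∀ {x} → OnLine a b c x → eval (trinomial a b c) x ≈ 0#
    on-line⇒root {x} on = x*y≈0⇒y≈0 (c≉0 ∘ on-line-at-0⇒c≈0 on) (begin
      x * eval (trinomial a b c) x       ≈⟨ x*trinomial≈ a b c x ⟩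
      a * x ^ p * x + b * x + c * x ^ p  ≈⟨ x^p*line≈ a b c x ⟨
      x ^ p * ((a * x + b * f x) + c)    ≈⟨ *-congˡ on ⟩
      x ^ p * 0#                         ≈⟨ zeroʳ _ ⟩
      0#                                 ∎)

  on-line⇒a*x^p+b≈0 : ∀ {a b c x} → c ≈ 0# → OnLine a b c x → x ≉ 0# → a * x ^ p + b ≈ 0#
  on-line⇒a*x^p+b≈0 {a} {b} {c} {x} c≈0 on x≉0 = x*y≈0⇒y≈0 x≉0 (begin
    x * (a * x ^ p + b)  ≈⟨ solve 4 (λ a b x xᵖ → x :* (a :* xᵖ :+ b) := a :* xᵖ :* x :+ b :* x)
        refl a b x (x ^ p) ⟩
    a * x ^ p * x + b * x              ≈⟨ +-identityʳ _ ⟨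
    a * x ^ p * x + b * x + 0#         ≈⟨ +-congˡ (trans (*-congʳ c≈0) (zeroˡ _)) ⟨
    a * x ^ p * x + b * x + c * x ^ p  ≈⟨ x^p*line≈ a b c x ⟨
    x ^ p * ((a * x + b * f x) + c)    ≈⟨ *-congˡ on ⟩
    x ^ p * 0#                         ≈⟨ zeroʳ _ ⟩
    0#                                 ∎)

  points-≤2 : ∀ {a b c} → b ≉ 0# → c ≈ 0# → points a b c ≤ 2
  points-≤2 {a} {b} {c} b≉0 c≈0 = cover (∃? (λ x → onLine? a b c x ×-dec ¬? (x ≟ 0#)) OnLine∧≉0-resp)
    where
    OnLine∧≉0-resp : ∀ {x y} → x ≈ y → OnLine a b c x × x ≉ 0# → OnLine a b c y × y ≉ 0#
    OnLine∧≉0-resp x≈y (on , x≉0) = OnLine-resp x≈y on , x≉0 ∘ trans x≈y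
    a≉0 : ∀ {x} → OnLine a b c x → x ≉ 0# → a ≉ 0#
    a≉0 on x≉0 a≈0 = b≉0 (trans (sym (trans (+-congʳ (trans (*-congʳ a≈0) (zeroˡ _))) (+-identityˡ b)))
                               (on-line⇒a*x^p+b≈0 c≈0 on x≉0))
    cover : Dec (∃ λ r → OnLine a b c r × r ≉ 0#) → points a b c ≤ 2
    cover (yes (r , on-r , r≉0)) = count-≤ (onLine? a b c) OnLine-resp {0# ∷ r ∷ []} λ on-x → ∈-0∷⁺ λ x≉0 →
      here (^p-injective (*-cancelˡ-≉0 (a≉0 on-x x≉0)
        (∙-cancelʳ b _ _ (trans (on-line⇒a*x^p+b≈0 c≈0 on-x x≉0) (sym (on-line⇒a*x^p+b≈0 c≈0 on-r r≉0))))))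
    cover (no ∄r) = ℕ.m≤n⇒m≤1+n (count-≤ (onLine? a b c) OnLine-resp {0# ∷ []} λ {x} on-x → ∈-0∷⁺ λ x≉0 →
      contradiction (x , on-x , x≉0) ∄r)

  lineCount-≤ : ∀ a b c → ¬ (a ≈ 0# × (b ≈ 0# × c ≈ 0#)) → lineCount f a b c ≤ p
  lineCount-≤ a b c abc≉0 with b ≟ 0#
  ... | yes b≈0 = ℕ.≤-trans (ℕ.+-monoˡ-≤ 1 (points-≤1 b≈0 λ (a≈0 , c≈0) → abc≉0 (a≈0 , b≈0 , c≈0))) 2≤p
  ... | no  b≉0 with c ≟ 0#
  ...   | yes c≈0 = ℕ.≤-trans (ℕ.≤-reflexive (ℕ.+-identityʳ _)) (ℕ.≤-trans (points-≤2 b≉0 c≈0) 2≤p)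
  ...   | no  c≉0 = ℕ.≤-trans (ℕ.≤-reflexive (ℕ.+-identityʳ _)) (points-≤p b≉0 c≉0)

  all-fixed⇒units-on-y≈1 : (∀ x → x ^ p ≈ x) → All (OnLine 0# 1# (- 1#)) units
  all-fixed⇒units-on-y≈1 fixed = All.map on-y≈1 units-≉0
    where
    on-y≈1 : ∀ {x} → x ≉ 0# → OnLine 0# 1# (- 1#) x
    on-y≈1 {x} x≉0 = begin
      (0# * x + 1# * f x) + - 1#  ≈⟨ +-congʳ (trans (+-cong (zeroˡ x) (*-identityˡ (f x))) (+-identityˡ (f x))) ⟩
      f x + - 1#                  ≈⟨ +-congʳ f[x]≈1 ⟩
      1# + - 1#                   ≈⟨ -‿inverseʳ 1# ⟩
      0#                          ∎
      where
      f[x]≈1 : f x ≈ 1#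
      f[x]≈1 = *-cancelˡ-≉0 x≉0 (trans (*-comm x (f x)) (trans (*-congˡ (sym (fixed x))) (trans (f[x]*x^p≈x x) (sym (*-identityʳ x)))))

  ¬all-fixed : ¬ (∀ x → x ^ p ≈ x)
  ¬all-fixed fixed = ℕ.<⇒≱ (1+n<n^2 2≤p) (≡.subst (_≤ suc p) (≡.sym q≡1+|units|) (s≤s |units|≤p))
    where
    |units|≤p : length units ≤ p
    |units|≤p = ℕ.≤-trans (≤-count (onLine? 0# 1# (- 1#)) OnLine-resp units-unique (all-fixed⇒units-on-y≈1 fixed))
                          (points-≤p 1≉0 -1≉0)

  ∃-non-fixed : ∃ λ α → α ^ p ≉ α
  ∃-non-fixed = decide (∃? (λ x → ¬? ((x ^ p) ≟ x)) non-fixed-resp)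
    where
    non-fixed-resp : ∀ {x y} → x ≈ y → x ^ p ≉ x → y ^ p ≉ y
    non-fixed-resp x≈y x^p≉x y^p≈y = x^p≉x (trans (^-congˡ p x≈y) (trans y^p≈y (sym x≈y)))
    decide : Dec (∃ λ α → α ^ p ≉ α) → ∃ λ α → α ^ p ≉ α
    decide (yes ∃α) = ∃α
    decide (no ∄α)  = contradiction (λ x → decidable-stable ((x ^ p) ≟ x) (λ x^p≉x → ∄α (x , x^p≉x))) ¬all-fixed

  α : Carrier
  α = proj₁ ∃-non-fixed

  m : Carrier
  m = α ^ p + - α

  ι : ℕ → Carrier
  ι i = i ×ₙ 1#

  t : ℕ → Carrier
  t i = α + ι i

  t[i]^p≈t[i]+m : ∀ i → t i ^ p ≈ t i + m
  t[i]^p≈t[i]+m i = begin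
    (α + ι i) ^ p            ≈⟨ frobenius-+ α (ι i) ⟩
    α ^ p + ι i ^ p          ≈⟨ +-congˡ (frobenius-×1 i) ⟩
    α ^ p + ι i              ≈⟨ +-identityʳ _ ⟨
    α ^ p + ι i + 0#         ≈⟨ +-congˡ (-‿inverseʳ α) ⟨
    α ^ p + ι i + (α + - α)  ≈⟨ solve 4 (λ αᵖ i a a⁻ → αᵖ :+ i :+ (a :+ a⁻) := a :+ i :+ (αᵖ :+ a⁻))
        refl (α ^ p) (ι i) α (- α) ⟩
    α + ι i + (α ^ p + - α)        ∎

  t≉0 : ∀ i → t i ≉ 0#
  t≉0 i t≈0 = proj₂ ∃-non-fixed (x∙y⁻¹≈ε⇒x≈y (α ^ p) α (begin
    m        ≈⟨ +-identityˡ m ⟨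
    0# + m   ≈⟨ +-congʳ t≈0 ⟨
    t i + m  ≈⟨ t[i]^p≈t[i]+m i ⟨
    t i ^ p  ≈⟨ ^-congˡ p t≈0 ⟩
    0# ^ p   ≈⟨ zero-^ p ⟩
    0#       ∎))

  u : ℕ → Carrier
  u i = proj₁ (inverse (t i) (t≉0 i))

  t*u≈1 : ∀ i → t i * u i ≈ 1#
  t*u≈1 i = proj₂ (inverse (t i) (t≉0 i))

  f[u]≈1+m*u : ∀ i → f (u i) ≈ 1# + m * u i
  f[u]≈1+m*u i = begin
    f (u i)                        ≈⟨ *-identityʳ _ ⟨
    f (u i) * 1#                   ≈⟨ *-congˡ (trans (^-congˡ p (trans (*-comm (u i) (t i)) (t*u≈1 i))) (one-^ p)) ⟨
    f (u i) * (u i * t i) ^ p      ≈⟨ *-congˡ (^-distrib-* (u i) (t i) p) ⟩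
    f (u i) * (u i ^ p * t i ^ p)  ≈⟨ *-assoc _ _ _ ⟨
    f (u i) * u i ^ p * t i ^ p    ≈⟨ *-cong (f[x]*x^p≈x (u i)) (t[i]^p≈t[i]+m i) ⟩
    u i * (t i + m)                ≈⟨ solve 3 (λ u t m → u :* (t :+ m) := t :* u :+ m :* u) refl (u i) (t i) m ⟩
    t i * u i + m * u i            ≈⟨ +-congʳ (t*u≈1 i) ⟩
    1# + m * u i                   ∎

  u-on-secant : ∀ i → OnLine (- m) 1# (- 1#) (u i)
  u-on-secant i = begin
    (- m * u i + 1# * f (u i)) + - 1#      ≈⟨ +-congʳ (+-cong (sym (-‿distribˡ-* m (u i))) (trans (*-identityˡ _) (f[u]≈1+m*u i))) ⟩
    (- (m * u i) + (1# + m * u i)) + - 1#  ≈⟨ solve 3 (λ y⁻ y o⁻ → (y⁻ :+ (con 1 :+ y)) :+ o⁻ := (y :+ y⁻) :+ (con 1 :+ o⁻))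
        refl (- (m * u i)) (m * u i) (- 1#) ⟩
    (m * u i + - (m * u i)) + (1# + - 1#)     ≈⟨ +-cong (-‿inverseʳ _) (-‿inverseʳ 1#) ⟩
    0# + 0#                                   ≈⟨ +-identityʳ 0# ⟩
    0#                                        ∎

  u-injective : ∀ {i j} → i < p → j < p → u i ≈ u j → i ≡ j
  u-injective {i} {j} i<p j<p ui≈uj = ×1-injective 1≉0 {i} {j} i<p j<p (∙-cancelˡ α (ι i) (ι j) ti≈tj)
    where
    u[i]≉0 : u i ≉ 0#
    u[i]≉0 ui≈0 = 1≉0 (trans (sym (t*u≈1 i)) (trans (*-congˡ ui≈0) (zeroʳ _)))
    ti≈tj : t i ≈ t j
    ti≈tj = *-cancelˡ-≉0 u[i]≉0 (begin
      u i * t i  ≈⟨ *-comm (u i) (t i) ⟩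
      t i * u i  ≈⟨ t*u≈1 i ⟩
      1#         ≈⟨ t*u≈1 j ⟨
      t j * u j  ≈⟨ *-congˡ ui≈uj ⟨
      t j * u i  ≈⟨ *-comm (t j) (u i) ⟩
      u i * t j  ∎)

  p≤lineCount-secant : p ≤ lineCount f (- m) 1# (- 1#)
  p≤lineCount-secant with 1# ≟ 0#
  ... | yes 1≈0 = contradiction 1≈0 1≉0
  ... | no  _   = ℕ.≤-trans p≤points (ℕ.≤-reflexive (≡.sym (ℕ.+-identityʳ _)))
    where
    p≤points : p ≤ points (- m) 1# (- 1#)
    p≤points = ≡.subst (_≤ points (- m) 1# (- 1#)) (length-applyUpTo u p)
      (≤-count (onLine? (- m) 1# (- 1#)) OnLine-resp
        (Unique.applyUpTo⁺₁ setoid u p λ i<j j<p ui≈uj → ℕ.<⇒≢ i<j (u-injective (ℕ.<-trans i<j j<p) j<p ui≈uj))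
        (All.applyUpTo⁺₁ u p λ {i} _ → u-on-secant i))

open import Data.Nat using (ℕ; _^_; _∸_)

theorem3p20 : (p : ℕ) → Prime p → (F : FiniteField (p ^ 2)) →
    PlaneCurve.deg F (λ x → FiniteField._^_ F x (p ^ 2 ∸ p)) ≡ p
theorem3p20 0             p-prime _ = contradiction p-prime ¬prime[0]
theorem3p20 1             p-prime _ = contradiction p-prime ¬prime[1]
theorem3p20 (suc (suc k)) p-prime F =
  ℕ.≤-antisym (deg-≤ f lineCount-≤) (≤-deg f (λ (_ , 1≈0 , _) → 1≉0 1≈0) p≤lineCount-secant)
  where
  open FiniteField F using (1≉0)
  open DegreeBounds F using (deg-≤; ≤-deg)
  open PowerCurve k p-prime F using (f; lineCount-≤; p≤lineCount-secant)
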